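{- For every $n\geq 1$, \[ \mathfrak{T}_n=\psi^{n}(\{01,10\})\ \cup\ \bigcup_{p=0}^{n-1}\psi^{p}(00)\,\mathcal{T}_{n-p}\ \cup\ \bigcup_{p=0}^{n-1}\psi^{p}(11)\,\mathcal{T}_{n-p}, \] where $\psi^p$ is the $p$-fold iterate of $\psi$ and $\psi^0$ is the identity.
   Context: Words are over $\{0,1\}$; $\varepsilon$ is the empty word, $w^k$ is $k$ concatenated copies of $w$, and for a word $u$ and set $X$ of words, $uX=\{uw:w\in X\}$. Define $\mathcal{T}_0=\varnothing$, $\mathcal{T}_1=\{0\}$, $\mathcal{T}_n=\{1^k01^{n-k-1}:0\leq k\leq n-1\}$ for $n\ge2$; $\mathcal{F}_0=\{\varepsilon\}$, $\mathcal{F}_1=\{1\}$, $\mathcal{F}_n=\{1^p01^k01^{n-p-k-2}:0\le p\le n-2,\ 0\le k\le n-p-2\}\cup\{1^n\}$ for $n\ge2$; $\mathfrak{T}_0=\{01,10\}$ and $\mathfrak{T}_n=01\mathcal{F}_n\cup10\mathcal{F}_n\cup00\mathcal{T}_n\cup11\mathcal{T}_n$ for $n\ge1$. (These are the encodings of the two-component states of the $n$-twist loop, the $n$-foil and the $n$-twist knot shadow respectively.) For a binary word $\omega=\alpha\beta$ of length at least $2$ with $\alpha$ its first two letters, define $\psi(\omega)=\mathfrak{p}(\alpha)\beta$, where $\mathfrak{p}(01)=011$, $\mathfrak{p}(10)=101$, $\mathfrak{p}(00)=010$, $\mathfrak{p}(11)=100$; $\psi$ is applied to sets elementwise. -}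

module Defs where

open import Data.Bool using (Bool; true; false)
open import Data.List using (List; []; _∷_; _++_; replicate)
open import Data.Nat using (ℕ; zero; suc; _+_; _∸_; _≤_; _<_)
open import Data.Product using (Σ; _×_; ∃; ∃-syntax; _,_)
open import Data.Sum using (_⊎_)
open import Data.Empty using (⊥)
open import Relation.Binary.PropositionalEquality using (_≡_)

-- Words over {0,1}: 0 = false, 1 = true
Word : Set
Word = List Bool

WordSet : Set₁
WordSet = Word → Set

_^ʷ_ : Word → ℕ → Word
w ^ʷ zero = []
w ^ʷ suc k = w ++ (w ^ʷ k)

𝟎 𝟏 : Word
𝟎 = false ∷ []
𝟏 = true ∷ []

⟦_⟧ : Word → WordSet
⟦ w ⟧ u = u ≡ w

_∪_ : WordSet → WordSet → WordSet
(X ∪ Y) u = X u ⊎ Y u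

_·_ : Word → WordSet → WordSet
(v · X) u = ∃[ w ] (X w × u ≡ v ++ w)

⋃<_ : ℕ → (ℕ → WordSet) → WordSet
(⋃< n) F u = ∃[ p ] (p < n × F p u)

_≐_ : WordSet → WordSet → Set
X ≐ Y = ∀ u → (X u → Y u) × (Y u → X u)

-- 𝒯_n : two-component states of the n-twist loop
-- 𝒯 0 = ∅, 𝒯 1 = {0}, 𝒯 n = {1^k 0 1^(n-k-1) : 0 ≤ k ≤ n-1} for n ≥ 2
𝒯 : ℕ → WordSet
𝒯 zero u = ⊥
𝒯 (suc zero) u = u ≡ 𝟎
𝒯 (suc (suc m)) u =
  ∃[ k ] (k ≤ suc m × u ≡ (𝟏 ^ʷ k) ++ 𝟎 ++ (𝟏 ^ʷ (suc (suc m) ∸ k ∸ 1)))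

-- ℱ_n : two-component states of the n-foil
ℱ : ℕ → WordSet
ℱ zero u = u ≡ []
ℱ (suc zero) u = u ≡ 𝟏
ℱ (suc (suc m)) u =
  (∃[ p ] ∃[ k ] (p ≤ m × k ≤ suc (suc m) ∸ p ∸ 2 ×
      u ≡ (𝟏 ^ʷ p) ++ 𝟎 ++ (𝟏 ^ʷ k) ++ 𝟎 ++ (𝟏 ^ʷ (suc (suc m) ∸ p ∸ k ∸ 2))))
  ⊎ u ≡ 𝟏 ^ʷ suc (suc m)

w01 w10 w00 w11 : Word
w01 = false ∷ true ∷ []
w10 = true ∷ false ∷ []
w00 = false ∷ false ∷ []
w11 = true ∷ true ∷ []

-- 𝔗_n : two-component states of the n-twist knot shadow
𝔗 : ℕ → WordSet
𝔗 zero = ⟦ w01 ⟧ ∪ ⟦ w10 ⟧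
𝔗 (suc m) = ((w01 · ℱ (suc m)) ∪ (w10 · ℱ (suc m)))
          ∪ ((w00 · 𝒯 (suc m)) ∪ (w11 · 𝒯 (suc m)))

-- ψ on words: ψ(αβ) = 𝔭(α)β, α the first two letters.
-- (ψ is only used on words of length ≥ 2; shorter words are left unchanged,
-- a convention that never matters here.)
ψ : Word → Word
ψ (false ∷ true ∷ β) = false ∷ true ∷ true ∷ β
ψ (true ∷ false ∷ β) = true ∷ false ∷ true ∷ β
ψ (false ∷ false ∷ β) = false ∷ true ∷ false ∷ β
ψ (true ∷ true ∷ β) = true ∷ false ∷ false ∷ β
ψ w = w

ψ^ : ℕ → Word → Word
ψ^ zero w = w
ψ^ (suc p) w = ψ (ψ^ p w)

ψ^Set : ℕ → WordSet → WordSet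
ψ^Set p X u = ∃[ w ] (X w × u ≡ ψ^ p w)

module Submission where

-- The twist-knot shadow 𝔗ₙ (n = m + 1) is by definition
--   𝔗ₙ = 01ℱₙ ∪ 10ℱₙ ∪ 00𝒯ₙ ∪ 11𝒯ₙ,
-- and the theorem regroups this union along the orbits of ψ.
--
-- 1. ψ inserts a 1 after a prefix 01 or 10, and sends 00 ↦ 010, 11 ↦ 100;
--    hence ψᵖ(01) = 01 1ᵖ, ψᵖ(10) = 10 1ᵖ, ψᵖ⁺¹(00) = 01 1ᵖ0 and
--    ψᵖ⁺¹(11) = 10 1ᵖ0  (the ψ-orbits).
-- 2. Every word of 𝒯_{a+1} is 1ᵏ0 1^{a-k} with k ≤ a, and a two-zero foil
--    word 1ᵖ0 1ᵏ0 1ʳ is 1ᵖ0 followed by such a twist-loop word; hence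
--    ℱₙ = {1ⁿ} ∪ ⋃_{p<m} 1ᵖ0 𝒯_{m-p}  (the foil decomposition).
-- 3. Splitting off the term p = 0 of each union over p < n in the statement
--    leaves 00𝒯ₙ (resp. 11𝒯ₙ) plus, by 1., exactly 01 (resp. 10) times the
--    union of 2.; the remaining term ψⁿ{01,10} is {01 1ⁿ, 10 1ⁿ}.

open import Defs
open import Data.Nat using (ℕ; zero; suc; _+_; _∸_; _≤_; z≤n; s≤s)
open import Data.Nat.Properties
  using (+-comm; ∸-+-assoc; +-∸-assoc; m+n∸m≡n; [m+n]∸[m+o]≡n∸o; m≤m+n; m≤n⇒∃[o]m+o≡n)
open import Data.List using (_++_)
open import Data.List.Properties using (++-assoc)
open import Data.Product using (∃-syntax; _×_; _,_; proj₁; proj₂)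
open import Data.Sum using (inj₁; inj₂) renaming (map to map⊎)
open import Relation.Binary.PropositionalEquality
  using (_≡_; refl; sym; trans; cong; subst; module ≡-Reasoning)

≐-refl : ∀ {X} → X ≐ X
≐-refl u = (λ x → x) , (λ x → x)

≐-sym : ∀ {X Y} → X ≐ Y → Y ≐ X
≐-sym X≐Y u = let (f , g) = X≐Y u in g , f

≐-trans : ∀ {X Y Z} → X ≐ Y → Y ≐ Z → X ≐ Z
≐-trans X≐Y Y≐Z u =
  let (f , g) = X≐Y u ; (f′ , g′) = Y≐Z u in (λ x → f′ (f x)) , (λ z → g (g′ z))

⟦⟧-cong : ∀ {v w} → v ≡ w → ⟦ v ⟧ ≐ ⟦ w ⟧
⟦⟧-cong refl = ≐-refl

prefix-≡ : ∀ {v w} X → v ≡ w → (v · X) ≐ (w · X)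
prefix-≡ X refl = ≐-refl

∪-cong : ∀ {X X′ Y Y′} → X ≐ X′ → Y ≐ Y′ → (X ∪ Y) ≐ (X′ ∪ Y′)
∪-cong X≐X′ Y≐Y′ u =
  let (f , f⁻¹) = X≐X′ u ; (g , g⁻¹) = Y≐Y′ u in map⊎ f g , map⊎ f⁻¹ g⁻¹

·-cong : ∀ v {X Y} → X ≐ Y → (v · X) ≐ (v · Y)
·-cong v X≐Y u =
  (λ { (w , Xw , refl) → w , proj₁ (X≐Y w) Xw , refl }) ,
  (λ { (w , Yw , refl) → w , proj₂ (X≐Y w) Yw , refl })

⋃-cong : ∀ n {F G} → (∀ p → F p ≐ G p) → (⋃< n) F ≐ (⋃< n) G
⋃-cong n F≐G u =
  (λ { (p , p<n , Fp) → p , p<n , proj₁ (F≐G p u) Fp }) ,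
  (λ { (p , p<n , Gp) → p , p<n , proj₂ (F≐G p u) Gp })

·-∪ : ∀ v X Y → (v · (X ∪ Y)) ≐ ((v · X) ∪ (v · Y))
·-∪ v X Y u =
  (λ { (w , inj₁ Xw , refl) → inj₁ (w , Xw , refl)
     ; (w , inj₂ Yw , refl) → inj₂ (w , Yw , refl) }) ,
  (λ { (inj₁ (w , Xw , refl)) → w , inj₁ Xw , refl
     ; (inj₂ (w , Yw , refl)) → w , inj₂ Yw , refl })

·-⋃ : ∀ v n F → (v · (⋃< n) F) ≐ (⋃< n) (λ p → v · F p)
·-⋃ v n F u =
  (λ { (w , (p , p<n , Fpw) , refl) → p , p<n , w , Fpw , refl }) ,
  (λ { (p , p<n , w , Fpw , refl) → w , (p , p<n , Fpw) , refl })

·-⟦⟧ : ∀ v w → (v · ⟦ w ⟧) ≐ ⟦ v ++ w ⟧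
·-⟦⟧ v w u = (λ { (_ , refl , refl) → refl }) , (λ { refl → w , refl , refl })

·-· : ∀ v w X → (v · (w · X)) ≐ ((v ++ w) · X)
·-· v w X u =
  (λ { (_ , (x , Xx , refl) , refl) → x , Xx , sym (++-assoc v w x) }) ,
  (λ { (x , Xx , refl) → w ++ x , (x , Xx , refl) , ++-assoc v w x })

⋃-peel : ∀ n F → (⋃< suc n) F ≐ (F 0 ∪ (⋃< n) (λ p → F (suc p)))
⋃-peel n F u =
  (λ { (zero , _ , F0u) → inj₁ F0u
     ; (suc p , s≤s p<n , Fu) → inj₂ (p , p<n , Fu) }) ,
  (λ { (inj₁ F0u) → zero , s≤s z≤n , F0u
     ; (inj₂ (p , p<n , Fu)) → suc p , s≤s p<n , Fu })

ψ^Set-pair : ∀ p a b → ψ^Set p (⟦ a ⟧ ∪ ⟦ b ⟧) ≐ (⟦ ψ^ p a ⟧ ∪ ⟦ ψ^ p b ⟧)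
ψ^Set-pair p a b u =
  (λ { (_ , inj₁ refl , refl) → inj₁ refl ; (_ , inj₂ refl , refl) → inj₂ refl }) ,
  (λ { (inj₁ refl) → a , inj₁ refl , refl ; (inj₂ refl) → b , inj₂ refl , refl })

regroup : ∀ {A B C D G H} →
  (((A ∪ G) ∪ (B ∪ H)) ∪ (C ∪ D)) ≐ (((A ∪ B) ∪ (C ∪ G)) ∪ (D ∪ H))
regroup u =
  (λ { (inj₁ (inj₁ (inj₁ a))) → inj₁ (inj₁ (inj₁ a))
     ; (inj₁ (inj₁ (inj₂ g))) → inj₁ (inj₂ (inj₂ g))
     ; (inj₁ (inj₂ (inj₁ b))) → inj₁ (inj₁ (inj₂ b))
     ; (inj₁ (inj₂ (inj₂ h))) → inj₂ (inj₂ h)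
     ; (inj₂ (inj₁ c)) → inj₁ (inj₂ (inj₁ c))
     ; (inj₂ (inj₂ d)) → inj₂ (inj₁ d) }) ,
  (λ { (inj₁ (inj₁ (inj₁ a))) → inj₁ (inj₁ (inj₁ a))
     ; (inj₁ (inj₁ (inj₂ b))) → inj₁ (inj₂ (inj₁ b))
     ; (inj₁ (inj₂ (inj₁ c))) → inj₂ (inj₁ c)
     ; (inj₁ (inj₂ (inj₂ g))) → inj₁ (inj₁ (inj₂ g))
     ; (inj₂ (inj₁ d)) → inj₂ (inj₂ d)
     ; (inj₂ (inj₂ h)) → inj₁ (inj₂ (inj₂ h)) })

∸-prefix : ∀ c p a → c + (p + a) ∸ p ≡ c + a
∸-prefix c p a = trans (+-∸-assoc c (m≤m+n p a)) (cong (c +_) (m+n∸m≡n p a))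

∸-∸-cancel : ∀ c n k → c + n ∸ k ∸ c ≡ n ∸ k
∸-∸-cancel c n k = trans (∸-+-assoc (c + n) k c)
  (trans (cong (c + n ∸_) (+-comm k c)) ([m+n]∸[m+o]≡n∸o c n k))

loopWord : ℕ → ℕ → Word
loopWord a k = (𝟏 ^ʷ k) ++ 𝟎 ++ (𝟏 ^ʷ (a ∸ k))

𝒯-intro : ∀ {a k} → k ≤ a → 𝒯 (suc a) (loopWord a k)
𝒯-intro {zero} z≤n = refl
𝒯-intro {suc a} {k} k≤a =
  k , k≤a , cong (λ r → (𝟏 ^ʷ k) ++ 𝟎 ++ (𝟏 ^ʷ r)) (sym (∸-∸-cancel 1 (suc a) k))

𝒯-elim : ∀ {a u} → 𝒯 (suc a) u → ∃[ k ] (k ≤ a × u ≡ loopWord a k)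
𝒯-elim {zero} u≡0 = 0 , z≤n , u≡0
𝒯-elim {suc a} (k , k≤a , refl) =
  k , k≤a , cong (λ r → (𝟏 ^ʷ k) ++ 𝟎 ++ (𝟏 ^ʷ r)) (∸-∸-cancel 1 (suc a) k)

-- The two-zero words of ℱ_{p+a+2} are the words 1ᵖ0 w with w a twist-loop
-- word of 𝒯_{a+1}: the bound on k and the word itself, rewritten.

foil-bound : ∀ p a → 2 + (p + a) ∸ p ∸ 2 ≡ a
foil-bound p a = cong (_∸ 2) (∸-prefix 2 p a)

foil-word : ∀ p a k →
  (𝟏 ^ʷ p) ++ 𝟎 ++ (𝟏 ^ʷ k) ++ 𝟎 ++ (𝟏 ^ʷ (2 + (p + a) ∸ p ∸ k ∸ 2))
    ≡ ((𝟏 ^ʷ p) ++ 𝟎) ++ loopWord a k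
foil-word p a k = begin
  (𝟏 ^ʷ p) ++ 𝟎 ++ (𝟏 ^ʷ k) ++ 𝟎 ++ (𝟏 ^ʷ (2 + (p + a) ∸ p ∸ k ∸ 2))
    ≡⟨ cong (λ r → (𝟏 ^ʷ p) ++ 𝟎 ++ (𝟏 ^ʷ k) ++ 𝟎 ++ (𝟏 ^ʷ r)) exponent ⟩
  (𝟏 ^ʷ p) ++ 𝟎 ++ loopWord a k
    ≡⟨ sym (++-assoc (𝟏 ^ʷ p) 𝟎 (loopWord a k)) ⟩
  ((𝟏 ^ʷ p) ++ 𝟎) ++ loopWord a k ∎
  where
  open ≡-Reasoning
  exponent : 2 + (p + a) ∸ p ∸ k ∸ 2 ≡ a ∸ k
  exponent = trans (cong (λ n → n ∸ k ∸ 2) (∸-prefix 2 p a)) (∸-∸-cancel 2 a k)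

foilTail : ℕ → WordSet
foilTail m = (⋃< m) (λ p → ((𝟏 ^ʷ p) ++ 𝟎) · 𝒯 (m ∸ p))

foil-split : ∀ m u → ℱ (suc m) u → (⟦ 𝟏 ^ʷ suc m ⟧ ∪ foilTail m) u
foil-split zero u u≡1 = inj₁ u≡1
foil-split (suc m) u (inj₂ u≡1ⁿ) = inj₁ u≡1ⁿ
foil-split (suc m) u (inj₁ (p , k , p≤m , k≤ , u≡)) with m≤n⇒∃[o]m+o≡n p≤m
... | a , refl =
  inj₂ (p , s≤s (m≤m+n p a) , loopWord a k ,
        subst (λ n → 𝒯 n (loopWord a k)) (sym (∸-prefix 1 p a))
              (𝒯-intro (subst (k ≤_) (foil-bound p a) k≤)) ,
        trans u≡ (foil-word p a k))

foil-join : ∀ m u → (⟦ 𝟏 ^ʷ suc m ⟧ ∪ foilTail m) u → ℱ (suc m) u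
foil-join zero u (inj₁ u≡1) = u≡1
foil-join (suc m) u (inj₁ u≡1ⁿ) = inj₂ u≡1ⁿ
foil-join (suc m) u (inj₂ (p , s≤s p≤m , w , Tw , refl)) with m≤n⇒∃[o]m+o≡n p≤m
... | a , refl with 𝒯-elim (subst (λ n → 𝒯 n w) (∸-prefix 1 p a) Tw)
... | k , k≤a , refl =
  inj₁ (p , k , m≤m+n p a , subst (k ≤_) (sym (foil-bound p a)) k≤a ,
        sym (foil-word p a k))

foil-decomposition : ∀ m → ℱ (suc m) ≐ (⟦ 𝟏 ^ʷ suc m ⟧ ∪ foilTail m)
foil-decomposition m u = foil-split m u , foil-join m u

prefix-foil : ∀ v m → (v · ℱ (suc m)) ≐
  (⟦ v ++ 𝟏 ^ʷ suc m ⟧ ∪ (⋃< m) (λ p → (v ++ (𝟏 ^ʷ p) ++ 𝟎) · 𝒯 (m ∸ p)))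
prefix-foil v m =
  ≐-trans (·-cong v (foil-decomposition m))
  (≐-trans (·-∪ v _ _)
  (∪-cong (·-⟦⟧ v _) (≐-trans (·-⋃ v m _) (⋃-cong m (λ p → ·-· v _ _)))))

-- The ψ-orbits of the four two-letter words: ψ inserts a 1 after 01 or 10.

ψ^-01 : ∀ p → ψ^ p w01 ≡ w01 ++ 𝟏 ^ʷ p
ψ^-01 zero = refl
ψ^-01 (suc p) = cong ψ (ψ^-01 p)

ψ^-10 : ∀ p → ψ^ p w10 ≡ w10 ++ 𝟏 ^ʷ p
ψ^-10 zero = refl
ψ^-10 (suc p) = cong ψ (ψ^-10 p)

ψ^-00 : ∀ p → ψ^ (suc p) w00 ≡ w01 ++ (𝟏 ^ʷ p) ++ 𝟎
ψ^-00 zero = refl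
ψ^-00 (suc p) = cong ψ (ψ^-00 p)

ψ^-11 : ∀ p → ψ^ (suc p) w11 ≡ w10 ++ (𝟏 ^ʷ p) ++ 𝟎
ψ^-11 zero = refl
ψ^-11 (suc p) = cong ψ (ψ^-11 p)

orbit-union : ∀ c v m → (∀ p → ψ^ (suc p) c ≡ v ++ (𝟏 ^ʷ p) ++ 𝟎) →
  (⋃< suc m) (λ p → ψ^ p c · 𝒯 (suc m ∸ p)) ≐
  ((c · 𝒯 (suc m)) ∪ (⋃< m) (λ p → (v ++ (𝟏 ^ʷ p) ++ 𝟎) · 𝒯 (m ∸ p)))
orbit-union c v m orbit =
  ≐-trans (⋃-peel m _) (∪-cong ≐-refl (⋃-cong m (λ p → prefix-≡ _ (orbit p))))

mainTheorem14 : (m : ℕ) → let n = suc m in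
    𝔗 n ≐ ((ψ^Set n (⟦ w01 ⟧ ∪ ⟦ w10 ⟧)
    ∪ (⋃< n) (λ p → ψ^ p w00 · 𝒯 (n ∸ p)))
    ∪ (⋃< n) (λ p → ψ^ p w11 · 𝒯 (n ∸ p)))
mainTheorem14 m =
  ≐-trans (∪-cong (∪-cong (prefix-foil w01 m) (prefix-foil w10 m)) ≐-refl)
  (≐-trans regroup
  (≐-sym (∪-cong (∪-cong ψⁿ-pair (orbit-union w00 w01 m ψ^-00))
                 (orbit-union w11 w10 m ψ^-11))))
  where
  ψⁿ-pair : ψ^Set (suc m) (⟦ w01 ⟧ ∪ ⟦ w10 ⟧) ≐
            (⟦ w01 ++ 𝟏 ^ʷ suc m ⟧ ∪ ⟦ w10 ++ 𝟏 ^ʷ suc m ⟧)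
  ψⁿ-pair = ≐-trans (ψ^Set-pair (suc m) w01 w10)
                    (∪-cong (⟦⟧-cong (ψ^-01 (suc m))) (⟦⟧-cong (ψ^-10 (suc m))))
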